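{- Let $n\ge 1$. The slither code map is a bijection from the set of rooted trees on the vertex set $\{1,\dots,n\}$ to the set of sequences $(s_1,\dots,s_{n-1})$ with all $s_i\in\{1,\dots,n\}$.
   Context: Let $T$ be a tree on $\{1,\dots,n\}$ rooted at some vertex, with edges directed away from the root. Vertices are classified as $P$-positions and $N$-positions: a vertex is a $P$-position iff none of its children is a $P$-position (leaves are $P$-positions), otherwise it is an $N$-position. The slither code of $T$ is computed as follows. Start with $n-1$ empty slots. Repeat $n-1$ times: among the non-root vertices of the current tree that have no remaining children (current leaves), remove the one with the smallest label; place its label in the leftmost empty slot if it is a $P$-position of the original tree $T$, and in the rightmost empty slot if it is an $N$-position of $T$ (the classification is always with respect to the original tree, not updated). This yields a sequence $(a_1,\dots,a_{n-1})$, a permutation of the non-root vertices. The slither code is $(s_1,\dots,s_{n-1})$ where $s_i$ is the parent of $a_i$ in $T$. -}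

module Defs where

open import Data.Nat using (ℕ; zero; suc; _∸_)
open import Data.Bool using (Bool; true; false; not; _∧_; _∨_)
open import Data.Fin using (Fin; _≟_)
open import Data.Maybe using (Maybe; just; nothing)
open import Data.Vec using (Vec; lookup)
open import Data.List using (List; []; _∷_; filter; reverse; mapMaybe; _++_; length)
open import Data.Bool.ListAction using (any; all)
open import Data.List using (allFin) renaming ([_] to ⟦_⟧)
open import Data.Product using (Σ; ∃; _×_; _,_)
open import Relation.Nullary using (does)
open import Relation.Binary.PropositionalEquality using (_≡_)

-- Vertices {1,…,n} are represented by Fin n (label i+1 ↦ i; order preserved).
-- A rooted tree is encoded by its parent vector: entry v is  just u  when
-- u is the parent of v (edge u → v, directed away from the root), and
-- nothing  when v is the root.
ParentVec : ℕ → Set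
ParentVec n = Vec (Maybe (Fin n)) n

module _ {n : ℕ} (p : ParentVec n) where

  ancestor : ℕ → Fin n → Maybe (Fin n)
  ancestor zero v = just v
  ancestor (suc k) v with lookup p v
  ... | nothing = nothing
  ... | just u = ancestor k u

  IsRootedTree : Set
  IsRootedTree =
    (Σ (Fin n) λ r → (lookup p r ≡ nothing) × (∀ v → lookup p v ≡ nothing → v ≡ r))
    × (∀ v → ∃ λ k → ancestor k v ≡ nothing)

  isRoot : Fin n → Bool
  isRoot v with lookup p v
  ... | nothing = true
  ... | just _ = false

  isChildOf : Fin n → Fin n → Bool
  isChildOf c v with lookup p c
  ... | nothing = false
  ... | just u = does (u ≟ v)

  children : Fin n → List (Fin n)
  children v = filter (λ c → isChildOf c v ≟b true) (allFin n)
    where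
    open import Data.Bool.Properties renaming (_≟_ to _≟b_)

  -- P-position with fuel: P iff no child is P (leaves are P).
  -- Fuel n exceeds the height of any subtree, so isP is the exact value.
  isPf : ℕ → Fin n → Bool
  isPf zero v = true
  isPf (suc k) v = not (any (isPf k) (children v))

  isP : Fin n → Bool
  isP = isPf n

  elem : Fin n → List (Fin n) → Bool
  elem v [] = false
  elem v (w ∷ ws) = does (v ≟ w) ∨ elem v ws

  -- current leaves: non-root, not yet removed, all children removed;
  -- listed in increasing label order (allFin is increasing).
  currentLeaves : List (Fin n) → List (Fin n)
  currentLeaves removed =
    filter (λ v → (not (isRoot v) ∧ not (elem v removed)
                    ∧ all (λ c → elem c removed) (children v)) ≟b true)
           (allFin n)
    where
    open import Data.Bool.Properties renaming (_≟_ to _≟b_)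

  removeSteps : ℕ → List (Fin n) → List (Fin n)
  removeSteps zero removed = removed
  removeSteps (suc k) removed with currentLeaves removed
  ... | [] = removed
  ... | v ∷ _ = removeSteps k (removed ++ ⟦ v ⟧)

  removalOrder : List (Fin n)
  removalOrder = removeSteps (n ∸ 1) []

  -- Slot filling: P-positions fill the empty slots from the left, in removal
  -- order; N-positions fill them from the right.
  aSeq : List (Fin n)
  aSeq = filter (λ v → isP v ≟b true) removalOrder
         ++ reverse (filter (λ v → isP v ≟b false) removalOrder)
    where
    open import Data.Bool.Properties renaming (_≟_ to _≟b_)

  slitherCode : List (Fin n)
  slitherCode = mapMaybe (lookup p) aSeq

{-# OPTIONS --safe #-}
module Submission where

-- Split the removal order of a tree as A ++ F, with A the vertices removed so far.
-- In the slither code the vertices of A occupy the outermost slots, so the code is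
-- their parents wrapped around a middle part M, which lists the parents of the
-- vertices not yet removed.  Hence A and M determine the next removed vertex: the
-- least vertex in neither A nor M (the root lies in M, being the parent of some
-- unremoved vertex).  All its children lie in A, so its P/N status is known, and
-- its parent is the first or the last entry of M.  This yields a decoder inverting
-- the code on trees.  Conversely, decoding any sequence of length n - 1 builds a
-- tree, as every vertex gets a parent that is removed after it or is the root; working
-- backwards from the end, the removal process of that tree retraces the decoding,
-- so its code is the given sequence.

open import Defs
open import Data.Bool using (Bool; true; false; not; _∧_; _∨_; T)
open import Data.Bool.ListAction using (any; all; or)
open import Data.Bool.Properties using (T-≡; T-∧) renaming (_≟_ to _≟ᵇ_)
open import Data.Empty using (⊥-elim)
open import Data.Fin using (Fin; _≟_)
open import Data.List
  using (List; []; _∷_; _++_; [_]; _∷ʳ_; length; allFin; filter; map; reverse; mapMaybe; catMaybes; initLast; _∷ʳ′_)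
open import Data.List.Membership.Propositional using (_∈_; _∉_)
open import Data.List.Membership.Propositional.Properties
  using (∈-∃++; ∈-++⁻; ∈-++⁺ˡ; ∈-++⁺ʳ; ∈-allFin; ∈-filter⁻; ∈-filter⁺)
open import Data.List.Properties
  using (length-++; length-tabulate; ++-assoc; ++-identityʳ; ++-cancelˡ; ∷-injective; filter-≐; map-cong-local;
         unfold-reverse; mapMaybe-++)
open import Data.List.Relation.Binary.Subset.Propositional using (_⊆_)
open import Data.List.Relation.Unary.All as All using (all?)
open import Data.List.Relation.Unary.All.Properties using (¬Any⇒All¬; ¬All⇒Any¬; all⁺; all⁻)
open import Data.List.Relation.Unary.Any using (here; there; satisfied)
open import Data.List.Relation.Unary.Unique.Propositional using (Unique; []; _∷_)
open import Data.List.Relation.Unary.Unique.Propositional.Properties as Unique using (allFin⁺)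
open import Data.Maybe using (Maybe; just; nothing)
open import Data.Maybe.Properties using (just-injective)
open import Data.Nat using (ℕ; zero; suc; _≤_; _<_; _∸_; _+_; z≤n; s≤s)
open import Data.Nat.Properties
  using (≤-refl; ≤-reflexive; ≤-<-trans; +-suc; +-comm; +-identityʳ; <⇒≱; 1+n≰n; m<m+n; suc-injective)
open import Data.Product using (Σ; ∃; _×_; _,_; proj₁; proj₂)
open import Data.Sum using (_⊎_; inj₁; inj₂)
open import Data.Vec using (lookup; replicate; _[_]≔_)
open import Data.Vec.Properties using (lookup∘update; lookup∘update′; lookup-replicate; tabulate∘lookup; tabulate-cong)
open import Function using (_∘_; _$_)
open import Function.Bundles using (_⇔_; mk⇔; Equivalence)
open import Relation.Binary.PropositionalEquality
  using (_≡_; _≢_; refl; sym; trans; cong; cong₂; subst; subst₂; module ≡-Reasoning)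
open import Relation.Nullary using (¬_; yes; no; does; _×-dec_)

open Equivalence using (to; from)

suc[n∸1]≡n : ∀ {n} → 1 ≤ n → suc (n ∸ 1) ≡ n
suc[n∸1]≡n {suc _} _ = refl

Fin⇒1≤ : ∀ {n} → Fin n → 1 ≤ n
Fin⇒1≤ {suc _} _ = s≤s z≤n

+-suc≡∸1⇒< : ∀ {a k n} → a + suc k ≡ n ∸ 1 → a + suc k < n
+-suc≡∸1⇒< {n = suc n} eq = s≤s (≤-reflexive eq)
+-suc≡∸1⇒< {a} {k} {zero} eq with trans (sym (+-suc a k)) eq
... | ()

T-not⇒¬T : ∀ {b} → T (not b) → ¬ T b
T-not⇒¬T {false} _ ()

¬T⇒T-not : ∀ {b} → ¬ T b → T (not b)
¬T⇒T-not {false} _ = _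
¬T⇒T-not {true} ¬t = ¬t _

module _ {A : Set} where

  ∈-++-∷⁻ : ∀ {x y : A} xs ys → y ∈ xs ++ x ∷ ys → y ≢ x → y ∈ xs ++ ys
  ∈-++-∷⁻ xs ys y∈ y≢x with ∈-++⁻ xs y∈
  ... | inj₁ y∈xs = ∈-++⁺ˡ y∈xs
  ... | inj₂ (here y≡x) = ⊥-elim (y≢x y≡x)
  ... | inj₂ (there y∈ys) = ∈-++⁺ʳ xs y∈ys

  length-++-∷ : ∀ (x : A) xs ys → length (xs ++ x ∷ ys) ≡ suc (length (xs ++ ys))
  length-++-∷ x xs ys = trans (length-++ xs) (trans (+-suc (length xs) (length ys)) (cong suc (sym (length-++ xs))))

  length-∷ʳ-+ : ∀ (xs : List A) x k → length (xs ∷ʳ x) + k ≡ length xs + suc k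
  length-∷ʳ-+ xs x k = trans (cong (_+ k) (trans (length-++ xs) (+-comm (length xs) 1))) (sym (+-suc (length xs) k))

  length-mono-⊆ : ∀ {xs ys : List A} → Unique xs → xs ⊆ ys → length xs ≤ length ys
  length-mono-⊆ [] _ = z≤n
  length-mono-⊆ {x ∷ xs} (x≢xs ∷ u) xs⊆ys with ∈-∃++ (xs⊆ys (here refl))
  ... | ys₁ , ys₂ , refl = subst (suc (length xs) ≤_) (sym (length-++-∷ x ys₁ ys₂))
    (s≤s (length-mono-⊆ u λ y∈ → ∈-++-∷⁻ ys₁ ys₂ (xs⊆ys (there y∈)) (λ y≡x → All.lookup x≢xs y∈ (sym y≡x))))

  Unique-∷ʳ : ∀ {xs : List A} {x} → Unique xs → x ∉ xs → Unique (xs ∷ʳ x)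
  Unique-∷ʳ u x∉xs = Unique.++⁺ u (All.[] ∷ []) λ { (x∈xs , here refl) → x∉xs x∈xs }

  Unique-++⇒∉ : ∀ {xs ys : List A} {x} → Unique (xs ++ ys) → x ∈ xs → x ∉ ys
  Unique-++⇒∉ {x ∷ xs} (x≢ ∷ _) (here refl) x∈ys = All.lookup x≢ (∈-++⁺ʳ xs x∈ys) refl
  Unique-++⇒∉ {x ∷ xs} (_ ∷ u) (there y∈xs) = Unique-++⇒∉ u y∈xs

  ∉-∷ʳ : ∀ {xs : List A} {x y} → y ∉ xs → y ≢ x → y ∉ xs ∷ʳ x
  ∉-∷ʳ {xs} y∉xs y≢x y∈ with ∈-++⁻ xs y∈
  ... | inj₁ y∈xs = y∉xs y∈xs
  ... | inj₂ (here y≡x) = y≢x y≡x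

  place : Bool → A → List A → List A
  place true u M = u ∷ M
  place false u M = M ∷ʳ u

  placeMaybe : Bool → Maybe A → List A → List A
  placeMaybe b nothing M = M
  placeMaybe b (just u) M = place b u M

  takeSlot : Bool → List A → Maybe (A × List A)
  takeSlot true [] = nothing
  takeSlot true (u ∷ M) = just (u , M)
  takeSlot false M with initLast M
  ... | [] = nothing
  ... | M′ ∷ʳ′ u = just (u , M′)

  initLast-∷ʳ : ∀ (xs : List A) x → initLast (xs ∷ʳ x) ≡ xs ∷ʳ′ x
  initLast-∷ʳ [] x = refl
  initLast-∷ʳ (y ∷ xs) x rewrite initLast-∷ʳ xs x = refl

  takeSlot-place : ∀ b u M → takeSlot b (place b u M) ≡ just (u , M)
  takeSlot-place true u M = refl
  takeSlot-place false u M rewrite initLast-∷ʳ M u = refl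

  takeSlot⇒place : ∀ b {M u M′} → takeSlot b M ≡ just (u , M′) → M ≡ place b u M′
  takeSlot⇒place true {u ∷ M} refl = refl
  takeSlot⇒place false {M} eq with initLast M
  takeSlot⇒place false {.(M′ ∷ʳ u)} refl | M′ ∷ʳ′ u = refl

  takeSlot-nonempty : ∀ b {M k} → length M ≡ suc k → ∃ λ u → ∃ λ M′ → takeSlot b M ≡ just (u , M′)
  takeSlot-nonempty true {u ∷ M} _ = u , M , refl
  takeSlot-nonempty false {M} |M| with initLast M
  takeSlot-nonempty false {.[]} () | []
  ... | M′ ∷ʳ′ u = u , M′ , refl

  length-place : ∀ b u M → length (place b u M) ≡ suc (length M)
  length-place true u M = refl
  length-place false u M = trans (length-++ M) (+-comm (length M) 1)

  ∈-place⇔ : ∀ b {x u M} → x ∈ place b u M ⇔ (x ≡ u ⊎ x ∈ M)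
  ∈-place⇔ true = mk⇔ (λ { (here x≡u) → inj₁ x≡u ; (there x∈M) → inj₂ x∈M })
                      (λ { (inj₁ x≡u) → here x≡u ; (inj₂ x∈M) → there x∈M })
  ∈-place⇔ false {M = M} = mk⇔ (λ x∈ → split (∈-++⁻ M x∈))
                                (λ { (inj₁ x≡u) → ∈-++⁺ʳ M (here x≡u) ; (inj₂ x∈M) → ∈-++⁺ˡ x∈M })
    where
    split : ∀ {x u} → x ∈ M ⊎ x ∈ [ u ] → x ≡ u ⊎ x ∈ M
    split (inj₁ x∈M) = inj₂ x∈M
    split (inj₂ (here x≡u)) = inj₁ x≡u

  catMaybes-∷ : ∀ (mu : Maybe A) xs → catMaybes (mu ∷ xs) ≡ placeMaybe true mu (catMaybes xs)
  catMaybes-∷ nothing xs = refl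
  catMaybes-∷ (just u) xs = refl

  ++-catMaybes-[] : ∀ (mu : Maybe A) M → M ++ catMaybes [ mu ] ≡ placeMaybe false mu M
  ++-catMaybes-[] nothing M = ++-identityʳ M
  ++-catMaybes-[] (just u) M = refl

module _ {n : ℕ} where
  open import Data.List.Membership.DecPropositional (_≟_ {n}) using (_∈?_; _∉?_)

  length-allFin : length (allFin n) ≡ n
  length-allFin = length-tabulate (λ v → v)

  Unique⇒length≤ : {xs : List (Fin n)} → Unique xs → length xs ≤ n
  Unique⇒length≤ {xs} u = subst (length xs ≤_) length-allFin (length-mono-⊆ u (λ {v} _ → ∈-allFin v))

  ∃∉ : (xs : List (Fin n)) → length xs < n → ∃ λ v → v ∉ xs
  ∃∉ xs |xs|<n with all? (_∈? xs) (allFin n)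
  ... | yes all∈ = ⊥-elim (<⇒≱ |xs|<n
    (subst (_≤ length xs) length-allFin (length-mono-⊆ (allFin⁺ n) (All.lookup all∈))))
  ... | no ¬all∈ = satisfied (¬All⇒Any¬ (_∈? xs) (allFin n) ¬all∈)

  ∉-unique : {R : List (Fin n)} → Unique R → length R ≡ n ∸ 1 → ∀ {x y} → x ∉ R → y ∉ R → x ≡ y
  ∉-unique {R} u |R| {x} {y} x∉R y∉R with x ≟ y
  ... | yes x≡y = x≡y
  ... | no x≢y = ⊥-elim (1+n≰n (subst (λ m → suc m ≤ n) (trans (cong suc |R|) (suc[n∸1]≡n (Fin⇒1≤ x)))
                   (Unique⇒length≤ ((x≢y All.∷ ¬Any⇒All¬ R x∉R) ∷ ¬Any⇒All¬ R y∉R ∷ u))))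

  free : List (Fin n) → List (Fin n) → List (Fin n)
  free A M = filter (λ v → (v ∉? A) ×-dec (v ∉? M)) (allFin n)

  ∈-free⁻ : ∀ {A M v} → v ∈ free A M → v ∉ A × v ∉ M
  ∈-free⁻ {A} {M} v∈ = proj₂ (∈-filter⁻ (λ v → (v ∉? A) ×-dec (v ∉? M)) {xs = allFin n} v∈)

  free-nonempty : ∀ {A M} → length A + length M < n → ∃ λ v → ∃ λ rest → free A M ≡ v ∷ rest
  free-nonempty {A} {M} short with ∃∉ (A ++ M) (subst (_< n) (sym (length-++ A)) short)
  ... | v , v∉
    with free A M | ∈-filter⁺ (λ v → (v ∉? A) ×-dec (v ∉? M)) (∈-allFin v) (v∉ ∘ ∈-++⁺ˡ , v∉ ∘ ∈-++⁺ʳ A)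
  ...   | w ∷ rest | _ = w , rest , refl

module _ {n : ℕ} (p : ParentVec n) where
  open import Data.List.Membership.DecPropositional (_≟_ {n}) using (_∈?_; _∉?_)

  NonRoot : Fin n → Set
  NonRoot v = ∃ λ u → lookup p v ≡ just u

  UniqueRoot : Set
  UniqueRoot = ∀ {x y} → lookup p x ≡ nothing → lookup p y ≡ nothing → x ≡ y

  DownClosed : List (Fin n) → Set
  DownClosed A = ∀ {c a} → lookup p c ≡ just a → a ∈ A → c ∈ A

  IsLeaf : List (Fin n) → Fin n → Set
  IsLeaf A v = NonRoot v × v ∉ A × (∀ {c} → lookup p c ≡ just v → c ∈ A)

  RemainingParents : List (Fin n) → List (Fin n) → Set
  RemainingParents A M = ∀ {u} → u ∈ M ⇔ ∃ λ w → w ∉ A × lookup p w ≡ just u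

  root⇒¬NonRoot : ∀ {v} → lookup p v ≡ nothing → ¬ NonRoot v
  root⇒¬NonRoot pv (u , pv′) with trans (sym pv) pv′
  ... | ()

  ¬NonRoot⇒root : ∀ {v} → ¬ NonRoot v → lookup p v ≡ nothing
  ¬NonRoot⇒root {v} ¬nr with lookup p v
  ... | nothing = refl
  ... | just u = ⊥-elim (¬nr (u , refl))

  T-not-isRoot⇔ : ∀ {v} → T (not (isRoot p v)) ⇔ NonRoot v
  T-not-isRoot⇔ {v} with lookup p v
  ... | nothing = mk⇔ (λ ()) (λ ())
  ... | just u = mk⇔ (λ _ → u , refl) (λ _ → _)

  elem≡does : ∀ v xs → elem p v xs ≡ does (v ∈? xs)
  elem≡does v [] = refl
  elem≡does v (w ∷ ws) = cong (does (v ≟ w) ∨_) (elem≡does v ws)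

  T-elem⇔ : ∀ {v xs} → T (elem p v xs) ⇔ v ∈ xs
  T-elem⇔ {v} {xs} rewrite elem≡does v xs with v ∈? xs
  ... | yes v∈xs = mk⇔ (λ _ → v∈xs) _
  ... | no v∉xs = mk⇔ (λ ()) v∉xs

  isChildOf≡true⇔ : ∀ {c v} → isChildOf p c v ≡ true ⇔ lookup p c ≡ just v
  isChildOf≡true⇔ {c} {v} with lookup p c
  ... | nothing = mk⇔ (λ ()) (λ ())
  ... | just u with u ≟ v
  ...   | yes refl = mk⇔ (λ _ → refl) (λ _ → refl)
  ...   | no u≢v = mk⇔ (λ ()) (λ { refl → ⊥-elim (u≢v refl) })

  ∈-children⇔ : ∀ {c v} → c ∈ children p v ⇔ lookup p c ≡ just v
  ∈-children⇔ {c} {v} = mk⇔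
    (λ c∈ → to isChildOf≡true⇔ (proj₂ (∈-filter⁻ (λ x → isChildOf p x v ≟ᵇ true) {xs = allFin n} c∈)))
    (λ pc≡v → ∈-filter⁺ (λ x → isChildOf p x v ≟ᵇ true) (∈-allFin c) (from isChildOf≡true⇔ pc≡v))

  leafTest : List (Fin n) → Fin n → Bool
  leafTest A v = not (isRoot p v) ∧ not (elem p v A) ∧ all (λ c → elem p c A) (children p v)

  leafTest≡true⇔ : ∀ {A v} → leafTest A v ≡ true ⇔ IsLeaf A v
  leafTest≡true⇔ {A} {v} = mk⇔ (leaf ∘ from T-≡) (to T-≡ ∘ unleaf)
    where
    leaf : T (leafTest A v) → IsLeaf A v
    leaf t = let r , t′ = to T-∧ t ; a , cs = to T-∧ t′ in
      to T-not-isRoot⇔ r ,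
      (λ v∈A → T-not⇒¬T a (from T-elem⇔ v∈A)) ,
      (λ pc≡v → to T-elem⇔ (All.lookup (all⁺ _ (children p v) cs) (from ∈-children⇔ pc≡v)))
    unleaf : IsLeaf A v → T (leafTest A v)
    unleaf (nr , v∉A , cs) = from T-∧ (from T-not-isRoot⇔ nr , from T-∧
      (¬T⇒T-not (v∉A ∘ to T-elem⇔) , all⁻ _ (All.tabulate (λ c∈ → from T-elem⇔ (cs (to ∈-children⇔ c∈))))))

  ∈-currentLeaves⇒IsLeaf : ∀ {A v} → v ∈ currentLeaves p A → IsLeaf A v
  ∈-currentLeaves⇒IsLeaf {A} v∈ =
    to leafTest≡true⇔ (proj₂ (∈-filter⁻ (λ v → leafTest A v ≟ᵇ true) {xs = allFin n} v∈))

  ancestor-root : ∀ k {w} → lookup p w ≡ nothing → ancestor p (suc k) w ≡ nothing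
  ancestor-root k pw rewrite pw = refl

  ancestor-parent : ∀ k {w a} → lookup p w ≡ just a → ancestor p (suc k) w ≡ ancestor p k a
  ancestor-parent k pw≡a rewrite pw≡a = refl

  root-reached : ∀ {A} → DownClosed A → ∀ k {w} → w ∉ A → NonRoot w → ancestor p k w ≡ nothing →
    ∃ λ w′ → w′ ∉ A × ∃ λ r → lookup p w′ ≡ just r × lookup p r ≡ nothing
  root-reached down zero w∉A nr ()
  root-reached down (suc k) {w} w∉A (a , pw≡a) anc with lookup p a in pa
  ... | nothing = w , w∉A , a , pw≡a , pa
  ... | just b = root-reached down k (λ a∈A → w∉A (down pw≡a a∈A)) (b , pa) (trans (sym (ancestor-parent k pw≡a)) anc)

  currentLeaves≡free : ∀ {A M} → UniqueRoot → DownClosed A →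
    (∀ {w} → w ∉ A → ∃ λ k → ancestor p k w ≡ nothing) →
    RemainingParents A M → (∃ λ w → w ∉ A × NonRoot w) → currentLeaves p A ≡ free A M
  currentLeaves≡free {A} {M} uniqueRoot down reach parents (w₀ , w₀∉A , nr₀) =
    filter-≐ (λ v → leafTest A v ≟ᵇ true) (λ v → (v ∉? A) ×-dec (v ∉? M))
             (leaf⇒free ∘ to leafTest≡true⇔ , from leafTest≡true⇔ ∘ free⇒leaf) (allFin n)
    where
    leaf⇒free : ∀ {v} → IsLeaf A v → v ∉ A × v ∉ M
    leaf⇒free (_ , v∉A , childrenRemoved) =
      v∉A , λ v∈M → let (w , w∉A , pw≡v) = to parents v∈M in w∉A (childrenRemoved pw≡v)
    free⇒leaf : ∀ {v} → v ∉ A × v ∉ M → IsLeaf A v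
    free⇒leaf {v} (v∉A , v∉M) = nonRoot , v∉A , childrenRemoved
      where
      -- The path from w₀ to the root stays outside the down-closed A, so the root is in M.
      nonRoot : NonRoot v
      nonRoot with lookup p v in pv
      ... | just u = u , refl
      ... | nothing =
        let (k , anc) = reach w₀∉A
            (w′ , w′∉A , r , pw′≡r , pr) = root-reached down k w₀∉A nr₀ anc
        in ⊥-elim (v∉M (from parents (w′ , w′∉A , subst (λ x → lookup p w′ ≡ just x) (uniqueRoot pr pv) pw′≡r)))
      childrenRemoved : ∀ {c} → lookup p c ≡ just v → c ∈ A
      childrenRemoved {c} pc≡v with c ∈? A
      ... | yes c∈A = c∈A
      ... | no c∉A = ⊥-elim (v∉M (from parents (c , c∉A , pc≡v)))

  DownClosed-∷ʳ : ∀ {A v} → DownClosed A → IsLeaf A v → DownClosed (A ∷ʳ v)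
  DownClosed-∷ʳ {A} down (_ , _ , childrenRemoved) pc≡a a∈ with ∈-++⁻ A a∈
  ... | inj₁ a∈A = ∈-++⁺ˡ (down pc≡a a∈A)
  ... | inj₂ (here refl) = ∈-++⁺ˡ (childrenRemoved pc≡a)

  record RemovalPrefix (A : List (Fin n)) : Set where
    field
      unique : Unique A
      nonRoot : ∀ {a} → a ∈ A → NonRoot a
      downClosed : DownClosed A

  RemovalPrefix-∷ʳ : ∀ {A v} → RemovalPrefix A → IsLeaf A v → RemovalPrefix (A ∷ʳ v)
  RemovalPrefix-∷ʳ {A} prefix leaf@(nonRootᵥ , v∉A , _) = record
    { unique = Unique-∷ʳ unique v∉A
    ; nonRoot = λ a∈ → nonRoot′ (∈-++⁻ A a∈)
    ; downClosed = DownClosed-∷ʳ downClosed leaf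
    }
    where
    open RemovalPrefix prefix
    nonRoot′ : ∀ {a} → a ∈ A ⊎ a ∈ [ _ ] → NonRoot a
    nonRoot′ (inj₁ a∈A) = nonRoot a∈A
    nonRoot′ (inj₂ (here refl)) = nonRootᵥ

  removeSteps-leaf : ∀ k {A v rest} → currentLeaves p A ≡ v ∷ rest →
    removeSteps p (suc k) A ≡ removeSteps p k (A ∷ʳ v)
  removeSteps-leaf k leaves rewrite leaves = refl

  removeSteps-extends : ∀ k A → ∃ λ F → removeSteps p k A ≡ A ++ F
  removeSteps-extends zero A = [] , sym (++-identityʳ A)
  removeSteps-extends (suc k) A with currentLeaves p A
  ... | [] = [] , sym (++-identityʳ A)
  ... | v ∷ _ = let (F , eq) = removeSteps-extends k (A ∷ʳ v) in v ∷ F , trans eq (++-assoc A [ v ] F)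

  removeSteps-∷ : ∀ k {A v F} → removeSteps p (suc k) A ≡ A ++ v ∷ F →
    (∃ λ rest → currentLeaves p A ≡ v ∷ rest) × removeSteps p k (A ∷ʳ v) ≡ (A ∷ʳ v) ++ F
  removeSteps-∷ k {A} {v} {F} removed with currentLeaves p A
  ... | [] with ++-cancelˡ A [] (v ∷ F) (trans (++-identityʳ A) removed)
  ...   | ()
  removeSteps-∷ k {A} {v} {F} removed | w ∷ rest with removeSteps-extends k (A ∷ʳ w)
  ... | G , extends
    with ∷-injective (++-cancelˡ A (w ∷ G) (v ∷ F) (trans (sym (++-assoc A [ w ] G)) (trans (sym extends) removed)))
  ...   | refl , refl = (rest , refl) , extends

  -- The parents of A fill the outer slots in order (P-positions from the left,
  -- N-positions from the right) around the middle part M.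
  frame : List (Fin n) → List (Fin n) → List (Fin n)
  frame [] M = M
  frame (a ∷ A) M = placeMaybe (isP p a) (lookup p a) (frame A M)

  positionsP positionsN : List (Fin n) → List (Fin n)
  positionsP = filter (λ v → isP p v ≟ᵇ true)
  positionsN = filter (λ v → isP p v ≟ᵇ false)

  mapMaybe-slots≡frame : ∀ L → mapMaybe (lookup p) (positionsP L ++ reverse (positionsN L)) ≡ frame L []
  mapMaybe-slots≡frame [] = refl
  mapMaybe-slots≡frame (v ∷ L) with isP p v
  ... | true = trans (catMaybes-∷ (lookup p v) (map (lookup p) (positionsP L ++ reverse (positionsN L))))
                     (cong (placeMaybe true (lookup p v)) (mapMaybe-slots≡frame L))
  ... | false = begin
    mapMaybe f (Ps ++ reverse (v ∷ Ns))                  ≡⟨ cong (λ ys → mapMaybe f (Ps ++ ys)) (unfold-reverse v Ns) ⟩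
    mapMaybe f (Ps ++ (reverse Ns ∷ʳ v))                 ≡⟨ cong (mapMaybe f) (sym (++-assoc Ps (reverse Ns) [ v ])) ⟩
    mapMaybe f ((Ps ++ reverse Ns) ∷ʳ v)                 ≡⟨ mapMaybe-++ f (Ps ++ reverse Ns) [ v ] ⟩
    mapMaybe f (Ps ++ reverse Ns) ++ mapMaybe f [ v ]    ≡⟨ cong (_++ mapMaybe f [ v ]) (mapMaybe-slots≡frame L) ⟩
    frame L [] ++ mapMaybe f [ v ]                       ≡⟨ ++-catMaybes-[] (f v) (frame L []) ⟩
    placeMaybe false (f v) (frame L [])                  ∎
    where
    open ≡-Reasoning
    f : Fin n → Maybe (Fin n)
    f = lookup p
    Ps Ns : List (Fin n)
    Ps = positionsP L
    Ns = positionsN L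

  slitherCode≡frame : slitherCode p ≡ frame (removalOrder p) []
  slitherCode≡frame = mapMaybe-slots≡frame (removalOrder p)

  frame-++ : ∀ A F M → frame (A ++ F) M ≡ frame A (frame F M)
  frame-++ [] F M = refl
  frame-++ (a ∷ A) F M = cong (placeMaybe (isP p a) (lookup p a)) (frame-++ A F M)

  length-frame : ∀ A M → (∀ {a} → a ∈ A → NonRoot a) → length (frame A M) ≡ length A + length M
  length-frame [] M _ = refl
  length-frame (a ∷ A) M nonRoot with nonRoot (here refl)
  ... | u , pa≡u rewrite pa≡u =
    trans (length-place (isP p a) u (frame A M)) (cong suc (length-frame A M (nonRoot ∘ there)))

  takeSlot-frame : ∀ {v u} F M → lookup p v ≡ just u → takeSlot (isP p v) (frame (v ∷ F) M) ≡ just (u , frame F M)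
  takeSlot-frame {v} {u} F M pv rewrite pv = takeSlot-place (isP p v) u (frame F M)

  ∈-frame⁻ : ∀ F {x} → x ∈ frame F [] → ∃ λ w → w ∈ F × lookup p w ≡ just x
  ∈-frame⁻ (w ∷ F) x∈ with lookup p w in pw
  ... | nothing = let (w′ , w′∈F , pw′) = ∈-frame⁻ F x∈ in w′ , there w′∈F , pw′
  ... | just u with to (∈-place⇔ (isP p w)) x∈
  ...   | inj₁ refl = w , here refl , pw
  ...   | inj₂ x∈′ = let (w′ , w′∈F , pw′) = ∈-frame⁻ F x∈′ in w′ , there w′∈F , pw′

  ∈-frame⁺ : ∀ F {w x} → w ∈ F → lookup p w ≡ just x → x ∈ frame F []
  ∈-frame⁺ (w ∷ F) (here refl) pw rewrite pw = from (∈-place⇔ (isP p w)) (inj₁ refl)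
  ∈-frame⁺ (w′ ∷ F) (there w∈F) pw with lookup p w′
  ... | nothing = ∈-frame⁺ F w∈F pw
  ... | just u = from (∈-place⇔ (isP p w′)) (inj₂ (∈-frame⁺ F w∈F pw))

module _ {n : ℕ} (p : ParentVec n) where

  record IsRestriction (t : ParentVec n) (A : List (Fin n)) : Set where
    field
      agree : ∀ {a} → a ∈ A → lookup t a ≡ lookup p a
      nonRoot⇒∈ : ∀ {c} → NonRoot t c → c ∈ A

module _ {n : ℕ} (p q : ParentVec n) where

  children-cong : ∀ {w} → (∀ {c} → lookup p c ≡ just w ⇔ lookup q c ≡ just w) → children p w ≡ children q w
  children-cong {w} same = filter-≐ (λ c → isChildOf p c w ≟ᵇ true) (λ c → isChildOf q c w ≟ᵇ true)
    (from (isChildOf≡true⇔ q) ∘ to same ∘ to (isChildOf≡true⇔ p) ,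
     from (isChildOf≡true⇔ p) ∘ from same ∘ to (isChildOf≡true⇔ q)) (allFin n)

  isPf-cong : (S : Fin n → Set) →
    (∀ {w c} → S w → lookup p c ≡ just w ⇔ lookup q c ≡ just w) →
    (∀ {w c} → S w → lookup p c ≡ just w → S c) →
    ∀ k {w} → S w → isPf p k w ≡ isPf q k w
  isPf-cong S same closed zero sw = refl
  isPf-cong S same closed (suc k) {w} sw = cong not (trans
    (cong or (map-cong-local (All.tabulate λ c∈ → isPf-cong S same closed k (closed sw (to (∈-children⇔ p) c∈)))))
    (cong (any (isPf q k)) (children-cong (same sw))))

  frame-cong : ∀ A M → (∀ {a} → a ∈ A → lookup p a ≡ lookup q a × isP p a ≡ isP q a) → frame p A M ≡ frame q A M
  frame-cong [] M _ = refl
  frame-cong (a ∷ A) M agree = trans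
    (cong₂ (λ b mu → placeMaybe b mu (frame p A M)) (proj₂ (agree (here refl))) (proj₁ (agree (here refl))))
    (cong (placeMaybe (isP q a) (lookup q a)) (frame-cong A M (agree ∘ there)))

  isP-restriction : ∀ {A v} → IsRestriction q p A → (∀ {c w} → lookup q c ≡ just w → w ∈ v ∷ A → c ∈ A) →
    ∀ {w} → w ∈ v ∷ A → isP p w ≡ isP q w
  isP-restriction {A} {v} restriction childrenIn = isPf-cong (_∈ v ∷ A) same closed n
    where
    open IsRestriction restriction
    same : ∀ {w c} → w ∈ v ∷ A → lookup p c ≡ just w ⇔ lookup q c ≡ just w
    same w∈ = mk⇔ (λ pc → trans (sym (agree (nonRoot⇒∈ (_ , pc)))) pc) (λ qc → trans (agree (childrenIn qc w∈)) qc)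
    closed : ∀ {w c} → w ∈ v ∷ A → lookup p c ≡ just w → c ∈ v ∷ A
    closed _ pc = there (nonRoot⇒∈ (_ , pc))

module _ {n : ℕ} {t : ParentVec n} {A : List (Fin n)} {v u : Fin n} where

  NonRoot-update⇒ : (∀ {c} → NonRoot t c → c ∈ A) → ∀ {c} → NonRoot (t [ v ]≔ just u) c → c ∈ A ∷ʳ v
  NonRoot-update⇒ nonRoot⇒∈ {c} (w , tc) with c ≟ v
  ... | yes refl = ∈-++⁺ʳ A (here refl)
  ... | no c≢v = ∈-++⁺ˡ (nonRoot⇒∈ (w , trans (sym (lookup∘update′ c≢v t (just u))) tc))

  NonRoot-update⇔ : v ∉ A → (∀ {c} → NonRoot t c ⇔ c ∈ A) →
    ∀ {c} → NonRoot (t [ v ]≔ just u) c ⇔ c ∈ A ∷ʳ v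
  NonRoot-update⇔ v∉A nonRoot⇔∈ {c} = mk⇔ (NonRoot-update⇒ (to nonRoot⇔∈)) ⇐
    where
    ⇐ : c ∈ A ∷ʳ v → NonRoot (t [ v ]≔ just u) c
    ⇐ c∈ with ∈-++⁻ A c∈
    ... | inj₁ c∈A =
      let (w , tc) = from nonRoot⇔∈ c∈A in w , trans (lookup∘update′ (λ { refl → v∉A c∈A }) t (just u)) tc
    ... | inj₂ (here refl) = u , lookup∘update v t (just u)

  IsRestriction-update : ∀ {p} → IsRestriction p t A → v ∉ A → lookup p v ≡ just u →
    IsRestriction p (t [ v ]≔ just u) (A ∷ʳ v)
  IsRestriction-update {p} restriction v∉A pv =
    record { agree = agree′ ; nonRoot⇒∈ = NonRoot-update⇒ nonRoot⇒∈ }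
    where
    open IsRestriction restriction
    agree′ : ∀ {a} → a ∈ A ∷ʳ v → lookup (t [ v ]≔ just u) a ≡ lookup p a
    agree′ a∈ with ∈-++⁻ A a∈
    ... | inj₁ a∈A = trans (lookup∘update′ (λ { refl → v∉A a∈A }) t (just u)) (agree a∈A)
    ... | inj₂ (here refl) = trans (lookup∘update v t (just u)) (sym pv)

module _ {n : ℕ} where

  -- isP t v is evaluated in the partial tree t, where all children of v are already attached.
  decodeFrom : ℕ → List (Fin n) → ParentVec n → List (Fin n) → List (Fin n) × ParentVec n
  decodeFrom zero A t M = A , t
  decodeFrom (suc k) A t M with free A M
  ... | [] = A , t
  ... | v ∷ _ with takeSlot (isP t v) M
  ...   | nothing = A , t
  ...   | just (u , M′) = decodeFrom k (A ∷ʳ v) (t [ v ]≔ just u) M′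

  decodeFrom-step : ∀ k {A t M v rest u M′} → free A M ≡ v ∷ rest → takeSlot (isP t v) M ≡ just (u , M′) →
    decodeFrom (suc k) A t M ≡ decodeFrom k (A ∷ʳ v) (t [ v ]≔ just u) M′
  decodeFrom-step k first slot rewrite first | slot = refl

  decode : List (Fin n) → ParentVec n
  decode s = proj₂ (decodeFrom (n ∸ 1) [] (replicate n nothing) s)

  replicate-¬NonRoot : ∀ {c} → ¬ NonRoot (replicate n nothing) c
  replicate-¬NonRoot {c} (u , e) with trans (sym (lookup-replicate c nothing)) e
  ... | ()

module RootedTree {n : ℕ} (p : ParentVec n) (tree : IsRootedTree p) where
  open import Data.List.Membership.DecPropositional (_≟_ {n}) using (_∈?_; _∉?_)

  root : Fin n
  root = proj₁ (proj₁ tree)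

  root-isRoot : lookup p root ≡ nothing
  root-isRoot = proj₁ (proj₂ (proj₁ tree))

  uniqueRoot : UniqueRoot p
  uniqueRoot px py = trans (proj₂ (proj₂ (proj₁ tree)) _ px) (sym (proj₂ (proj₂ (proj₁ tree)) _ py))

  reach : ∀ {w} → ∃ λ k → ancestor p k w ≡ nothing
  reach {w} = proj₂ tree w

  ≢root⇒NonRoot : ∀ {w} → w ≢ root → NonRoot p w
  ≢root⇒NonRoot {w} w≢root with lookup p w in pw
  ... | just u = u , refl
  ... | nothing = ⊥-elim (w≢root (uniqueRoot pw root-isRoot))

  NonRoot⇒≢root : ∀ {w} → NonRoot p w → w ≢ root
  NonRoot⇒≢root nr refl = root⇒¬NonRoot p root-isRoot nr

  -- Counting: the unremoved non-roots U have |U| parents, and A, U and the root are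
  -- disjoint, so some vertex is neither removed nor a parent of an unremoved vertex.
  leaves-nonempty : ∀ {A} → RemovalPrefix p A → suc (length A) < n →
    ∃ λ v → ∃ λ rest → currentLeaves p A ≡ v ∷ rest
  leaves-nonempty {A} prefix short =
    subst (λ L → ∃ λ v → ∃ λ rest → L ≡ v ∷ rest) (sym leaves≡free) (free-nonempty fewer)
    where
    open RemovalPrefix prefix
    U : List (Fin n)
    U = filter (_∉? (root ∷ A)) (allFin n)
    ∈U⁻ : ∀ {w} → w ∈ U → w ∉ root ∷ A
    ∈U⁻ w∈U = proj₂ (∈-filter⁻ (_∉? (root ∷ A)) {xs = allFin n} w∈U)
    nonRootU : ∀ {w} → w ∈ U → NonRoot p w
    nonRootU w∈U = ≢root⇒NonRoot (∈U⁻ w∈U ∘ here)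
    parents : RemainingParents p A (frame p U [])
    parents = mk⇔
      (λ u∈ → let (w , w∈U , pw≡u) = ∈-frame⁻ p U u∈ in w , ∈U⁻ w∈U ∘ there , pw≡u)
      (λ (w , w∉A , pw≡u) → ∈-frame⁺ p U (∈-filter⁺ (_∉? (root ∷ A)) (∈-allFin w)
        (λ { (here refl) → NonRoot⇒≢root (_ , pw≡u) refl ; (there w∈A) → w∉A w∈A })) pw≡u)
    unremoved : ∃ λ w → w ∉ A × NonRoot p w
    unremoved = let (w , w∉) = ∃∉ (root ∷ A) short in w , w∉ ∘ there , ≢root⇒NonRoot (w∉ ∘ here)
    leaves≡free : currentLeaves p A ≡ free A (frame p U [])
    leaves≡free = currentLeaves≡free p uniqueRoot downClosed (λ _ → reach) parents unremoved
    root∉ : root ∉ A ++ U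
    root∉ r∈ with ∈-++⁻ A r∈
    ... | inj₁ r∈A = NonRoot⇒≢root (nonRoot r∈A) refl
    ... | inj₂ r∈U = ∈U⁻ r∈U (here refl)
    distinct : Unique (root ∷ A ++ U)
    distinct = ¬Any⇒All¬ (A ++ U) root∉ ∷ Unique.++⁺ unique (Unique.filter⁺ (_∉? (root ∷ A)) (allFin⁺ n))
                 (λ (a∈A , a∈U) → ∈U⁻ a∈U (there a∈A))
    fewer : length A + length (frame p U []) < n
    fewer = subst (_< n)
      (trans (length-++ A) (cong (length A +_) (sym (trans (length-frame p U [] nonRootU) (+-identityʳ _)))))
      (Unique⇒length≤ distinct)

  removeSteps-prefix : ∀ k {A} → RemovalPrefix p A → length A + k ≡ n ∸ 1 →
    RemovalPrefix p (removeSteps p k A) × length (removeSteps p k A) ≡ n ∸ 1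
  removeSteps-prefix zero {A} prefix |A| = prefix , trans (sym (+-identityʳ (length A))) |A|
  removeSteps-prefix (suc k) {A} prefix |A|
    with leaves-nonempty prefix (≤-<-trans (m<m+n (length A) (s≤s z≤n)) (+-suc≡∸1⇒< |A|))
  ... | v , rest , leaves =
    subst (λ R → RemovalPrefix p R × length R ≡ n ∸ 1) (sym (removeSteps-leaf p k leaves)) $
      removeSteps-prefix k (RemovalPrefix-∷ʳ p prefix (∈-currentLeaves⇒IsLeaf p (subst (v ∈_) (sym leaves) (here refl))))
        (trans (length-∷ʳ-+ A v k) |A|)

  order : List (Fin n)
  order = removalOrder p

  order-facts : RemovalPrefix p order × length order ≡ n ∸ 1
  order-facts = removeSteps-prefix (n ∸ 1) record { unique = [] ; nonRoot = λ () ; downClosed = λ _ () } refl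

  open RemovalPrefix (proj₁ order-facts) renaming (unique to order-unique; nonRoot to order-nonRoot)

  ∈-order⇔NonRoot : ∀ {v} → v ∈ order ⇔ NonRoot p v
  ∈-order⇔NonRoot {v} = mk⇔ order-nonRoot nonRoot⇒∈
    where
    nonRoot⇒∈ : NonRoot p v → v ∈ order
    nonRoot⇒∈ nr with v ∈? order
    ... | yes v∈ = v∈
    ... | no v∉ = ⊥-elim (NonRoot⇒≢root nr (∉-unique order-unique (proj₂ order-facts) v∉
                    (λ r∈ → NonRoot⇒≢root (order-nonRoot r∈) refl)))

  length-slitherCode : length (slitherCode p) ≡ n ∸ 1
  length-slitherCode = begin
    length (slitherCode p)       ≡⟨ cong length (slitherCode≡frame p) ⟩
    length (frame p order [])    ≡⟨ length-frame p order [] order-nonRoot ⟩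
    length order + 0             ≡⟨ +-identityʳ _ ⟩
    length order                 ≡⟨ proj₂ order-facts ⟩
    n ∸ 1                        ∎
    where open ≡-Reasoning

  restriction-to-order : ∀ {t} → IsRestriction p t order → t ≡ p
  restriction-to-order {t} restriction =
    trans (sym (tabulate∘lookup t)) (trans (tabulate-cong same) (tabulate∘lookup p))
    where
    open IsRestriction restriction
    same : ∀ c → lookup t c ≡ lookup p c
    same c with c ∈? order
    ... | yes c∈ = agree c∈
    ... | no c∉ = trans (¬NonRoot⇒root t (c∉ ∘ nonRoot⇒∈)) (sym (¬NonRoot⇒root p (c∉ ∘ from ∈-order⇔NonRoot)))

  decodeFrom-frame : ∀ F {A t} → removeSteps p (length F) A ≡ A ++ F → A ++ F ≡ order →
    DownClosed p A → IsRestriction p t A → proj₂ (decodeFrom (length F) A t (frame p F [])) ≡ p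
  decodeFrom-frame [] {A} _ A≡order _ restriction =
    restriction-to-order (subst (IsRestriction p _) (trans (sym (++-identityʳ A)) A≡order) restriction)
  decodeFrom-frame (v ∷ F) {A} {t} removed A++F≡order down restriction with removeSteps-∷ p (length F) removed
  ... | (rest , leaves) , removed′ with ∈-currentLeaves⇒IsLeaf p (subst (v ∈_) (sym leaves) (here refl))
  ...   | leaf@((u , pv) , v∉A , childrenRemoved) =
    trans (cong proj₂ (decodeFrom-step (length F) first slot))
          (decodeFrom-frame F removed′ (trans (++-assoc A [ v ] F) A++F≡order) (DownClosed-∷ʳ p down leaf)
            (IsRestriction-update restriction v∉A pv))
    where
    parents : RemainingParents p A (frame p (v ∷ F) [])
    parents = mk⇔
      (λ x∈ → let (w , w∈F , pw) = ∈-frame⁻ p (v ∷ F) x∈ in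
        w , (λ w∈A → Unique-++⇒∉ (subst Unique (sym A++F≡order) order-unique) w∈A w∈F) , pw)
      (λ (w , w∉A , pw) → ∈-frame⁺ p (v ∷ F)
        (∈F (∈-++⁻ A (subst (w ∈_) (sym A++F≡order) (from ∈-order⇔NonRoot (_ , pw)))) w∉A) pw)
      where
      ∈F : ∀ {w} → w ∈ A ⊎ w ∈ v ∷ F → w ∉ A → w ∈ v ∷ F
      ∈F (inj₁ w∈A) w∉A = ⊥-elim (w∉A w∈A)
      ∈F (inj₂ w∈F) _ = w∈F
    first : free A (frame p (v ∷ F) []) ≡ v ∷ rest
    first = trans (sym (currentLeaves≡free p uniqueRoot down (λ _ → reach) parents (v , v∉A , u , pv))) leaves
    childrenIn : ∀ {c w} → lookup p c ≡ just w → w ∈ v ∷ A → c ∈ A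
    childrenIn pc (here refl) = childrenRemoved pc
    childrenIn pc (there w∈A) = down pc w∈A
    slot : takeSlot (isP t v) (frame p (v ∷ F) []) ≡ just (u , frame p F [])
    slot = trans
      (cong (λ b → takeSlot b (frame p (v ∷ F) [])) (isP-restriction t p restriction childrenIn (here refl)))
      (takeSlot-frame p F [] pv)

  decode-slitherCode : decode (slitherCode p) ≡ p
  decode-slitherCode =
    subst₂ (λ k s → proj₂ (decodeFrom k [] (replicate n nothing) s) ≡ p) (proj₂ order-facts) (sym (slitherCode≡frame p))
      (decodeFrom-frame order (subst (λ k → removeSteps p k [] ≡ order) (sym (proj₂ order-facts)) refl) refl (λ _ ())
        record { agree = λ () ; nonRoot⇒∈ = ⊥-elim ∘ replicate-¬NonRoot })

module Sequence {n : ℕ} (s : List (Fin n)) where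

  record Decoding (k : ℕ) (A : List (Fin n)) (t : ParentVec n) (M : List (Fin n)) : Set where
    field
      unique : Unique A
      nonRoot⇔∈ : ∀ {c} → NonRoot t c ⇔ c ∈ A
      disjoint : ∀ {u} → u ∈ M → u ∉ A
      code : s ≡ frame t A M
      removed : length A + k ≡ n ∸ 1
      remaining : length M ≡ k

  record Move (A : List (Fin n)) (t : ParentVec n) (M : List (Fin n)) : Set where
    field
      vertex parent : Fin n
      rest M′ : List (Fin n)
      first : free A M ≡ vertex ∷ rest
      slot : takeSlot (isP t vertex) M ≡ just (parent , M′)

  move : ∀ {k A t M} → Decoding (suc k) A t M → Move A t M
  move {k} {A} {t} {M} decoding =
    let (v , rest , first) = free-nonempty {A = A} {M = M}
                               (subst (λ m → length A + m < n) (sym remaining) (+-suc≡∸1⇒< removed))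
        (u , M′ , slot) = takeSlot-nonempty (isP t v) remaining
    in record { vertex = v ; parent = u ; rest = rest ; M′ = M′ ; first = first ; slot = slot }
    where open Decoding decoding

  module Step {k A t M} (decoding : Decoding (suc k) A t M) (m : Move A t M) where
    open Decoding decoding
    open Move m public renaming (vertex to v; parent to u)

    t′ : ParentVec n
    t′ = t [ v ]≔ just u

    v∉A : v ∉ A
    v∉A = proj₁ (∈-free⁻ (subst (v ∈_) (sym first) (here refl)))

    v∉M : v ∉ M
    v∉M = proj₂ (∈-free⁻ (subst (v ∈_) (sym first) (here refl)))

    M≡place : M ≡ place (isP t v) u M′
    M≡place = takeSlot⇒place (isP t v) slot

    ∈M⇔ : ∀ {x} → x ∈ M ⇔ (x ≡ u ⊎ x ∈ M′)
    ∈M⇔ {x} = subst (λ L → x ∈ L ⇔ (x ≡ u ⊎ x ∈ M′)) (sym M≡place) (∈-place⇔ (isP t v))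

    u∉A : u ∉ A
    u∉A = disjoint (from ∈M⇔ (inj₁ refl))

    u≢v : u ≢ v
    u≢v u≡v = v∉M (from ∈M⇔ (inj₁ (sym u≡v)))

    t-restricts : IsRestriction t′ t A
    t-restricts = record
      { agree = λ a∈A → sym (lookup∘update′ (λ { refl → v∉A a∈A }) t (just u))
      ; nonRoot⇒∈ = to nonRoot⇔∈ }

    childrenIn : ∀ {c w} → lookup t′ c ≡ just w → w ∈ v ∷ A → c ∈ A
    childrenIn {c} t′c w∈ with c ≟ v
    ... | no c≢v = to nonRoot⇔∈ (_ , trans (sym (lookup∘update′ c≢v t (just u))) t′c)
    ... | yes refl with trans (sym (lookup∘update v t (just u))) t′c | w∈
    ...   | refl | here u≡v = ⊥-elim (u≢v u≡v)
    ...   | refl | there u∈A = ⊥-elim (u∉A u∈A)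

    isP-t≡t′ : ∀ {w} → w ∈ v ∷ A → isP t w ≡ isP t′ w
    isP-t≡t′ = isP-restriction t t′ t-restricts childrenIn

    code′ : s ≡ frame t′ (A ∷ʳ v) M′
    code′ = begin
      s                                              ≡⟨ code ⟩
      frame t A M                                    ≡⟨ cong (frame t A) M≡place ⟩
      frame t A (place (isP t v) u M′)
        ≡⟨ frame-cong t t′ A _ (λ a∈A → IsRestriction.agree t-restricts a∈A , isP-t≡t′ (there a∈A)) ⟩
      frame t′ A (place (isP t v) u M′)
        ≡⟨ cong (λ b → frame t′ A (place b u M′)) (isP-t≡t′ (here refl)) ⟩
      frame t′ A (placeMaybe (isP t′ v) (just u) M′)
        ≡⟨ cong (λ mu → frame t′ A (placeMaybe (isP t′ v) mu M′)) (sym (lookup∘update v t (just u))) ⟩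
      frame t′ A (frame t′ [ v ] M′)                 ≡⟨ sym (frame-++ t′ A [ v ] M′) ⟩
      frame t′ (A ∷ʳ v) M′                           ∎
      where open ≡-Reasoning

    decoding′ : Decoding k (A ∷ʳ v) t′ M′
    decoding′ = record
      { unique = Unique-∷ʳ unique v∉A
      ; nonRoot⇔∈ = NonRoot-update⇔ {t = t} v∉A nonRoot⇔∈
      ; disjoint = λ x∈M′ x∈ → excluded (∈-++⁻ A x∈) x∈M′
      ; code = code′
      ; removed = trans (length-∷ʳ-+ A v k) removed
      ; remaining =
          suc-injective (trans (sym (length-place (isP t v) u M′)) (trans (cong length (sym M≡place)) remaining))
      }
      where
      excluded : ∀ {x} → x ∈ A ⊎ x ∈ [ v ] → x ∉ M′
      excluded (inj₁ x∈A) x∈M′ = disjoint (from ∈M⇔ (inj₂ x∈M′)) x∈A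
      excluded (inj₂ (here refl)) x∈M′ = v∉M (from ∈M⇔ (inj₂ x∈M′))

    decodeFrom-move : decodeFrom (suc k) A t M ≡ decodeFrom k (A ∷ʳ v) t′ M′
    decodeFrom-move = decodeFrom-step k first slot

  decodeFrom-decoding : ∀ k {A t M R q} → Decoding k A t M → decodeFrom k A t M ≡ (R , q) →
    Decoding 0 R q [] × IsRestriction q t A
  decodeFrom-decoding zero {M = []} decoding refl =
    decoding , record { agree = λ _ → refl ; nonRoot⇒∈ = to (Decoding.nonRoot⇔∈ decoding) }
  decodeFrom-decoding zero {M = _ ∷ _} decoding _ with Decoding.remaining decoding
  ... | ()
  decodeFrom-decoding (suc k) {A} {t} {M} {R} {q} decoding decoded =
    proj₁ IH ,
    record { agree = λ a∈A → trans (IsRestriction.agree t-restricts a∈A) (IsRestriction.agree (proj₂ IH) (∈-++⁺ˡ a∈A))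
           ; nonRoot⇒∈ = to (Decoding.nonRoot⇔∈ decoding) }
    where
    open Step decoding (move decoding)
    IH : Decoding 0 R q [] × IsRestriction q t′ (A ∷ʳ v)
    IH = decodeFrom-decoding k decoding′ (trans (sym decodeFrom-move) decoded)

  module Final {R q} (final : Decoding 0 R q []) where
    open Decoding final

    |R| : length R ≡ n ∸ 1
    |R| = trans (sym (+-identityʳ (length R))) removed

    uniqueRoot : UniqueRoot q
    uniqueRoot qx qy =
      ∉-unique unique |R| (root⇒¬NonRoot q qx ∘ from nonRoot⇔∈) (root⇒¬NonRoot q qy ∘ from nonRoot⇔∈)

    -- What the final tree q looks like at an intermediate stage (A, M) of the decoding;
    -- these facts involve later choices of the decoder, so they are proved backwards.
    record Settled (A M : List (Fin n)) : Set where
      field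
        parents : RemainingParents q A M
        downClosed : DownClosed q A
        reach : ∀ {w} → w ∉ A → ∃ λ k → ancestor q k w ≡ nothing

    Settled-step : ∀ {k A t M} (decoding : Decoding (suc k) A t M) → let open Step decoding (move decoding) in
      lookup q v ≡ just u → Settled (A ∷ʳ v) M′ → Settled A M
    Settled-step {A = A} {M = M} decoding qv settled′ =
      record { parents = parents′ ; downClosed = downClosed′ ; reach = reach′ }
      where
      open Step decoding (move decoding)
      open Settled settled′
      parents′ : RemainingParents q A M
      parents′ {x} = mk⇔ ⇒ ⇐
        where
        ⇒ : x ∈ M → ∃ λ w → w ∉ A × lookup q w ≡ just x
        ⇒ x∈M with to ∈M⇔ x∈M
        ... | inj₁ refl = v , v∉A , qv
        ... | inj₂ x∈M′ = let (w , w∉ , qw) = to parents x∈M′ in w , w∉ ∘ ∈-++⁺ˡ , qw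
        ⇐ : (∃ λ w → w ∉ A × lookup q w ≡ just x) → x ∈ M
        ⇐ (w , w∉A , qw) with w ≟ v
        ... | yes refl = from ∈M⇔ (inj₁ (just-injective (trans (sym qw) qv)))
        ... | no w≢v = from ∈M⇔ (inj₂ (from parents (w , ∉-∷ʳ w∉A w≢v , qw)))
      downClosed′ : DownClosed q A
      downClosed′ qc a∈A with ∈-++⁻ A (downClosed qc (∈-++⁺ˡ a∈A))
      ... | inj₁ c∈A = c∈A
      ... | inj₂ (here refl) = ⊥-elim (u∉A (subst (_∈ A) (just-injective (trans (sym qc) qv)) a∈A))
      reach′ : ∀ {w} → w ∉ A → ∃ λ k → ancestor q k w ≡ nothing
      reach′ {w} w∉A with w ≟ v
      ... | yes refl = let (k , anc) = reach (∉-∷ʳ u∉A u≢v) in suc k , trans (ancestor-parent q k qv) anc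
      ... | no w≢v = reach (∉-∷ʳ w∉A w≢v)

    settled : ∀ k {A t M} → Decoding k A t M → decodeFrom k A t M ≡ (R , q) → Settled A M × removeSteps q k A ≡ R
    settled zero {M = []} _ refl = record
      { parents = mk⇔ (λ ()) (λ (w , w∉R , qw) → ⊥-elim (w∉R (to nonRoot⇔∈ (_ , qw))))
      ; downClosed = λ qc _ → to nonRoot⇔∈ (_ , qc)
      ; reach = λ w∉R → 1 , ancestor-root q 0 (¬NonRoot⇒root q (w∉R ∘ to nonRoot⇔∈))
      } , refl
    settled zero {M = _ ∷ _} decoding _ with Decoding.remaining decoding
    ... | ()
    settled (suc k) {A} {t} {M} decoding decoded = settledA , trans (removeSteps-leaf q k leaves) (proj₂ IH)
      where
      open Step decoding (move decoding)
      decoded′ : decodeFrom k (A ∷ʳ v) t′ M′ ≡ (R , q)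
      decoded′ = trans (sym decodeFrom-move) decoded
      IH : Settled (A ∷ʳ v) M′ × removeSteps q k (A ∷ʳ v) ≡ R
      IH = settled k decoding′ decoded′
      qv : lookup q v ≡ just u
      qv = trans (sym (IsRestriction.agree (proj₂ (decodeFrom-decoding k decoding′ decoded′)) (∈-++⁺ʳ A (here refl))))
                 (lookup∘update v t (just u))
      settledA : Settled A M
      settledA = Settled-step decoding qv (proj₁ IH)
      open Settled settledA
      leaves : currentLeaves q A ≡ v ∷ rest
      leaves = trans (currentLeaves≡free q uniqueRoot downClosed reach parents (v , v∉A , u , qv)) first

  surjective : 1 ≤ n → length s ≡ n ∸ 1 → IsRootedTree (decode s) × slitherCode (decode s) ≡ s
  surjective 1≤n |s| =
    ((x , qx , λ w qw → uniqueRoot qw qx) , λ w → Settled.reach (proj₁ settled₀) {w} (λ ())) , code≡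
    where
    start : Decoding (n ∸ 1) [] (replicate n nothing) s
    start = record { unique = [] ; nonRoot⇔∈ = mk⇔ (⊥-elim ∘ replicate-¬NonRoot) (λ ()) ; disjoint = λ _ ()
                   ; code = refl ; removed = refl ; remaining = |s| }
    R : List (Fin n)
    R = proj₁ (decodeFrom (n ∸ 1) [] (replicate n nothing) s)
    q : ParentVec n
    q = decode s
    final : Decoding 0 R q []
    final = proj₁ (decodeFrom-decoding (n ∸ 1) start refl)
    open Final final
    open Decoding final
    settled₀ : Settled [] s × removeSteps q (n ∸ 1) [] ≡ R
    settled₀ = settled (n ∸ 1) start refl
    missing : ∃ λ x → x ∉ R
    missing = ∃∉ R (subst (_< n) (sym |R|) (subst (n ∸ 1 <_) (suc[n∸1]≡n 1≤n) ≤-refl))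
    x : Fin n
    x = proj₁ missing
    qx : lookup q x ≡ nothing
    qx = ¬NonRoot⇒root q (proj₂ missing ∘ to nonRoot⇔∈)
    code≡ : slitherCode q ≡ s
    code≡ = begin
      slitherCode q                  ≡⟨ slitherCode≡frame q ⟩
      frame q (removalOrder q) []    ≡⟨ cong (λ L → frame q L []) (proj₂ settled₀) ⟩
      frame q R []                   ≡⟨ sym code ⟩
      s                              ∎
      where open ≡-Reasoning

proposition5 : (n : ℕ) → 1 ≤ n →
    -- the slither code of a rooted tree is a sequence of length n - 1
    ((p : ParentVec n) → IsRootedTree p → length (slitherCode p) ≡ n ∸ 1)
    -- injective on rooted trees
    × ((p q : ParentVec n) → IsRootedTree p → IsRootedTree q →
        slitherCode p ≡ slitherCode q → p ≡ q)
    -- surjective onto sequences in {1,…,n}^(n-1)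
    × ((s : List (Fin n)) → length s ≡ n ∸ 1 →
        Σ (ParentVec n) λ p → IsRootedTree p × (slitherCode p ≡ s))
proposition5 n 1≤n =
  (λ p tree → RootedTree.length-slitherCode p tree) ,
  injective ,
  (λ s |s| → decode s , Sequence.surjective s 1≤n |s|)
  where
  injective : (p q : ParentVec n) → IsRootedTree p → IsRootedTree q → slitherCode p ≡ slitherCode q → p ≡ q
  injective p q treeₚ tree_q same = begin
    p                        ≡⟨ sym (RootedTree.decode-slitherCode p treeₚ) ⟩
    decode (slitherCode p)   ≡⟨ cong decode same ⟩
    decode (slitherCode q)   ≡⟨ RootedTree.decode-slitherCode q tree_q ⟩
    q                        ∎
    where open ≡-Reasoning
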